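{- For every $n\geqslant 0$, $$\widehat{B}_n(x)=\sum_{k=0}^{\lfloor n/2\rfloor}2^kM(n,k)(1+x^2)^k(1+x)^{n-2k}.$$ Equivalently, $\widehat{B}_n(x)=(1+x)^nM_n\!\left(\frac{2+2x^2}{(1+x)^2}\right)$.
   Context: Let $\mathcal{S}^B_n$ be the set of signed permutations $\sigma$ of $\{\pm1,\dots,\pm n\}$ with $\sigma(-i)=-\sigma(i)$, written as $\sigma(0)\sigma(1)\cdots\sigma(n)$ with $\sigma(0)=0$. A position $j\in\{0,\dots,n-1\}$ is an alternating descent of $\sigma$ if $j$ is even and $\sigma(j)<\sigma(j+1)$, or $j$ is odd and $\sigma(j)>\sigma(j+1)$; ${\rm altdes}_B(\sigma)$ is their number, and $\widehat{B}_n(x)=\sum_{\sigma\in\mathcal{S}^B_n}x^{{\rm altdes}_B(\sigma)}$ ($\widehat B_0=1$). For a permutation $\pi$ of $[n]$ with the convention $\pi(0)=0$, a left peak is an index $i\in[n-1]$ with $\pi(i-1)<\pi(i)>\pi(i+1)$; ${\rm lpk}(\pi)$ is the number of left peaks. $M(n,k)$ is the number of permutations of $[n]$ with $k$ left peaks and $M_n(x)=\sum_k M(n,k)x^k$ ($M_0(x)=1$). -}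

module Defs where

open import Data.Bool using (Bool; true; false; if_then_else_; _∧_; not)
open import Data.Nat using (ℕ; zero; suc; _+_; _*_; _∸_; _^_; _/_; _<ᵇ_; _≡ᵇ_)
open import Data.Integer as ℤ using (ℤ; +_; -[1+_]; ∣_∣)
open import Data.List using (List; []; _∷_; map; concatMap; filter; length; sum; upTo; replicate; _++_; foldr)
open import Data.Bool.ListAction using (any)
open import Relation.Nullary using (does)
import Data.Integer.Properties as ℤP

-- Polynomials with natural-number coefficients, as coefficient lists
-- (constant term first).

Poly : Set
Poly = List ℕ

coeff : Poly → ℕ → ℕ
coeff []       _       = 0
coeff (a ∷ p)  zero    = a
coeff (a ∷ p)  (suc j) = coeff p j

infixl 6 _⊕_
infixl 7 _⊗_

_⊕_ : Poly → Poly → Poly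
[]      ⊕ q       = q
(a ∷ p) ⊕ []      = a ∷ p
(a ∷ p) ⊕ (b ∷ q) = (a + b) ∷ (p ⊕ q)

scale : ℕ → Poly → Poly
scale c = map (c *_)

_⊗_ : Poly → Poly → Poly
[]      ⊗ q = []
(a ∷ p) ⊗ q = scale a q ⊕ (0 ∷ (p ⊗ q))

constP : ℕ → Poly
constP c = c ∷ []

monoP : ℕ → Poly
monoP k = replicate k 0 ++ (1 ∷ [])

powP : Poly → ℕ → Poly
powP p zero    = constP 1
powP p (suc k) = p ⊗ powP p k

sumP : List Poly → Poly
sumP = foldr _⊕_ []

infix 4 _≈P_
_≈P_ : Poly → Poly → Set
p ≈P q = ∀ j → coeff p j ≡ coeff q j
  where open import Relation.Binary.PropositionalEquality using (_≡_)

seqs : {A : Set} → List A → ℕ → List (List A)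
seqs xs zero    = [] ∷ []
seqs xs (suc n) = concatMap (λ x → map (x ∷_) (seqs xs n)) xs

distinctℕ : List ℕ → Bool
distinctℕ []       = true
distinctℕ (x ∷ xs) = not (any (x ≡ᵇ_) xs) ∧ distinctℕ xs

oneTo : ℕ → List ℕ
oneTo n = map suc (upTo n)

-- Permutations of [n], written π(1) ... π(n): injective words of length n over [n].
perms : ℕ → List (List ℕ)
perms n = filter (λ w → Data.Bool._≟_ (distinctℕ w) true) (seqs (oneTo n) n)
  where import Data.Bool

-- Signed permutations of [n], written σ(1) ... σ(n): words of length n over
-- {±1,…,±n} whose absolute values are pairwise distinct (σ(-i) = -σ(i) is then
-- determined).
signedVals : ℕ → List ℤ
signedVals n = map (λ i → + i) (oneTo n) ++ map (λ i → ℤ.- (+ i)) (oneTo n)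

signedPerms : ℕ → List (List ℤ)
signedPerms n =
  filter (λ w → Data.Bool._≟_ (distinctℕ (map ∣_∣ w)) true) (seqs (signedVals n) n)
  where import Data.Bool

even? : ℕ → Bool
even? zero          = true
even? (suc zero)    = false
even? (suc (suc n)) = even? n

_<ℤᵇ_ : ℤ → ℤ → Bool
a <ℤᵇ b = does (a ℤ.<? b)

-- number of alternating descents of a word, the first letter being at position j
altdesFrom : ℕ → List ℤ → ℕ
altdesFrom j []            = 0
altdesFrom j (a ∷ [])      = 0
altdesFrom j (a ∷ b ∷ w)   =
  (if (if even? j then a <ℤᵇ b else b <ℤᵇ a) then 1 else 0) + altdesFrom (suc j) (b ∷ w)

-- altdes_B(σ), computed on σ(0)σ(1)…σ(n) with σ(0) = 0
altdesB : List ℤ → ℕ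
altdesB σ = altdesFrom 0 (+ 0 ∷ σ)

peaks : List ℕ → ℕ
peaks (a ∷ b ∷ c ∷ w) =
  (if (a <ᵇ b) ∧ (c <ᵇ b) then 1 else 0) + peaks (b ∷ c ∷ w)
peaks _ = 0

-- left peaks of π: peaks of π(0)π(1)…π(n) with π(0) = 0, at indices i ∈ [n-1]
lpk : List ℕ → ℕ
lpk π = peaks (0 ∷ π)

BHat : ℕ → Poly
BHat n = sumP (map (λ σ → monoP (altdesB σ)) (signedPerms n))

M : ℕ → ℕ → ℕ
M n k = length (filter (λ π → Data.Bool._≟_ (lpk π ≡ᵇ k) true) (perms n))
  where import Data.Bool

RHS : ℕ → Poly
RHS n = sumP (map term (upTo (suc (n / 2))))
  where
  term : ℕ → Poly
  term k = constP (2 ^ k * M n k)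
           ⊗ powP (1 ∷ 0 ∷ 1 ∷ []) k
           ⊗ powP (1 ∷ 1 ∷ []) (n ∸ 2 * k)

-- Write a signed permutation σ as the permutation u = ∣σ∣ together with a
-- sign vector. Comparing σ(j) with σ(j+1), only the sign of the entry of larger
-- absolute value matters. Summing x^altdes_B over the 2^n sign vectors of a
-- fixed u therefore factorises letter by letter, the factor of a letter of 0u
-- depending only on how many of its neighbours are smaller: 2 for a valley
-- (a final letter reached by a descent counts as one), 1 + x² for a peak and
-- 1 + x otherwise. Peaks and valleys of 0u alternate, so for lpk(u) = k the sum
-- is 2^k (1 + x²)^k (1 + x)^(n-2k); grouping the permutations by k gives the
-- formula.
module Submission where

open import Defs
open import Data.Nat using (ℕ; zero; suc; _+_; _*_; _^_; _∸_; _/_; _<_; _≤_; _<ᵇ_; _≡ᵇ_; s≤s; z≤n)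
open import Data.Nat.DivMod using (m*n/n≡m; /-monoˡ-≤)
open import Data.Nat.Properties
open import Data.Bool using (Bool; true; false; if_then_else_; not; _∧_)
open import Data.List using (List; []; _∷_; map; concatMap; filter; _++_; length; upTo; applyUpTo)
open import Data.List.Relation.Unary.All as All using (All; []; _∷_)
open import Data.List.Relation.Unary.All.Properties using (concat⁺; map⁺; filter⁺; all-filter)
import Data.Integer as ℤ
import Data.Integer.Properties as ℤP
import Data.Bool as 𝔹
open import Data.Bool.Properties using (T-≡)
open import Data.Bool.ListAction using (any)
open import Data.Empty using (⊥; ⊥-elim)
open import Data.Unit using (⊤)
open import Data.Product using (Σ; _×_; _,_)
open import Relation.Binary.Definitions using (tri<; tri≈; tri>)
open import Function.Bundles using (Equivalence)
open import Relation.Nullary using (does)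
open import Relation.Nullary.Decidable using (dec-true; dec-false)
open import Relation.Unary using (Decidable)
open import Relation.Binary.PropositionalEquality
open import Relation.Binary.Bundles using (Setoid)
import Relation.Binary.Reasoning.Setoid
open import Relation.Binary.Structures using (IsEquivalence)
open import Algebra.Bundles using (CommutativeSemigroup)
import Algebra.Properties.CommutativeSemigroup as CommutativeSemigroupProperties

open CommutativeSemigroupProperties +-commutativeSemigroup using (interchange)

-- Cauchy products of coefficient sequences

shift : (ℕ → ℕ) → ℕ → ℕ
shift f i = f (suc i)

conv : (ℕ → ℕ) → (ℕ → ℕ) → ℕ → ℕ
conv f g zero    = f 0 * g 0
conv f g (suc j) = f 0 * g (suc j) + conv (shift f) g j

conv-cong : ∀ {f f′ g g′} → (∀ i → f i ≡ f′ i) → (∀ i → g i ≡ g′ i) →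
            ∀ j → conv f g j ≡ conv f′ g′ j
conv-cong f≗f′ g≗g′ zero    = cong₂ _*_ (f≗f′ 0) (g≗g′ 0)
conv-cong f≗f′ g≗g′ (suc j) =
  cong₂ _+_ (cong₂ _*_ (f≗f′ 0) (g≗g′ (suc j))) (conv-cong (λ i → f≗f′ (suc i)) g≗g′ j)

conv-zeroˡ : ∀ g j → conv (λ _ → 0) g j ≡ 0
conv-zeroˡ g zero    = refl
conv-zeroˡ g (suc j) = conv-zeroˡ g j

conv-*ˡ : ∀ c f g j → conv (λ i → c * f i) g j ≡ c * conv f g j
conv-*ˡ c f g zero    = *-assoc c (f 0) (g 0)
conv-*ˡ c f g (suc j) = begin
  c * f 0 * g (suc j) + conv (λ i → c * f (suc i)) g j  ≡⟨ cong₂ _+_ (*-assoc c _ _) (conv-*ˡ c (shift f) g j) ⟩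
  c * (f 0 * g (suc j)) + c * conv (shift f) g j        ≡⟨ *-distribˡ-+ c _ _ ⟨
  c * conv f g (suc j)                                  ∎
  where open ≡-Reasoning

conv-distribʳ : ∀ f f′ g j → conv (λ i → f i + f′ i) g j ≡ conv f g j + conv f′ g j
conv-distribʳ f f′ g zero    = *-distribʳ-+ (g 0) (f 0) (f′ 0)
conv-distribʳ f f′ g (suc j) = begin
  (f 0 + f′ 0) * g (suc j) + conv (λ i → f (suc i) + f′ (suc i)) g j
    ≡⟨ cong₂ _+_ (*-distribʳ-+ (g (suc j)) (f 0) (f′ 0)) (conv-distribʳ (shift f) (shift f′) g j) ⟩
  (f 0 * g (suc j) + f′ 0 * g (suc j)) + (conv (shift f) g j + conv (shift f′) g j)
    ≡⟨ interchange (f 0 * g (suc j)) (f′ 0 * g (suc j)) _ _ ⟩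
  conv f g (suc j) + conv f′ g (suc j) ∎
  where open ≡-Reasoning

conv-distribˡ : ∀ f g g′ j → conv f (λ i → g i + g′ i) j ≡ conv f g j + conv f g′ j
conv-distribˡ f g g′ zero    = *-distribˡ-+ (f 0) (g 0) (g′ 0)
conv-distribˡ f g g′ (suc j) = begin
  f 0 * (g (suc j) + g′ (suc j)) + conv (shift f) (λ i → g i + g′ i) j
    ≡⟨ cong₂ _+_ (*-distribˡ-+ (f 0) (g (suc j)) (g′ (suc j))) (conv-distribˡ (shift f) g g′ j) ⟩
  (f 0 * g (suc j) + f 0 * g′ (suc j)) + (conv (shift f) g j + conv (shift f) g′ j)
    ≡⟨ interchange (f 0 * g (suc j)) (f 0 * g′ (suc j)) _ _ ⟩
  conv f g (suc j) + conv f g′ (suc j) ∎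
  where open ≡-Reasoning

conv-sucʳ : ∀ f g j → conv f g (suc j) ≡ conv f (shift g) j + f (suc j) * g 0
conv-sucʳ f g zero    = refl
conv-sucʳ f g (suc j) = begin
  f 0 * g (suc (suc j)) + conv (shift f) g (suc j)
    ≡⟨ cong (f 0 * g (suc (suc j)) +_) (conv-sucʳ (shift f) g j) ⟩
  f 0 * g (suc (suc j)) + (conv (shift f) (shift g) j + f (suc (suc j)) * g 0)
    ≡⟨ +-assoc (f 0 * g (suc (suc j))) _ _ ⟨
  conv f (shift g) (suc j) + f (suc (suc j)) * g 0 ∎
  where open ≡-Reasoning

conv-comm : ∀ f g j → conv f g j ≡ conv g f j
conv-comm f g zero    = *-comm (f 0) (g 0)
conv-comm f g (suc j) = begin
  f 0 * g (suc j) + conv (shift f) g j  ≡⟨ cong₂ _+_ (*-comm (f 0) (g (suc j))) (conv-comm (shift f) g j) ⟩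
  g (suc j) * f 0 + conv g (shift f) j  ≡⟨ +-comm (g (suc j) * f 0) _ ⟩
  conv g (shift f) j + g (suc j) * f 0  ≡⟨ conv-sucʳ g f j ⟨
  conv g f (suc j)                      ∎
  where open ≡-Reasoning

conv-assoc : ∀ f g h j → conv (conv f g) h j ≡ conv f (conv g h) j
conv-assoc f g h zero    = *-assoc (f 0) (g 0) (h 0)
conv-assoc f g h (suc j) = begin
  f 0 * g 0 * h (suc j) + conv (λ i → f 0 * g (suc i) + conv (shift f) g i) h j
    ≡⟨ cong (f 0 * g 0 * h (suc j) +_) (conv-distribʳ (λ i → f 0 * g (suc i)) (conv (shift f) g) h j) ⟩
  f 0 * g 0 * h (suc j) + (conv (λ i → f 0 * g (suc i)) h j + conv (conv (shift f) g) h j)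
    ≡⟨ cong₂ (λ x y → f 0 * g 0 * h (suc j) + (x + y)) (conv-*ˡ (f 0) (shift g) h j) (conv-assoc (shift f) g h j) ⟩
  f 0 * g 0 * h (suc j) + (f 0 * conv (shift g) h j + conv (shift f) (conv g h) j)
    ≡⟨ +-assoc (f 0 * g 0 * h (suc j)) _ _ ⟨
  f 0 * g 0 * h (suc j) + f 0 * conv (shift g) h j + conv (shift f) (conv g h) j
    ≡⟨ cong (λ x → x + f 0 * conv (shift g) h j + conv (shift f) (conv g h) j) (*-assoc (f 0) (g 0) (h (suc j))) ⟩
  f 0 * (g 0 * h (suc j)) + f 0 * conv (shift g) h j + conv (shift f) (conv g h) j
    ≡⟨ cong (_+ conv (shift f) (conv g h) j) (*-distribˡ-+ (f 0) _ _) ⟨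
  conv f (conv g h) (suc j) ∎
  where open ≡-Reasoning

coeff-⊕ : ∀ p q j → coeff (p ⊕ q) j ≡ coeff p j + coeff q j
coeff-⊕ []      q       j       = refl
coeff-⊕ (a ∷ p) []      j       = sym (+-identityʳ _)
coeff-⊕ (a ∷ p) (b ∷ q) zero    = refl
coeff-⊕ (a ∷ p) (b ∷ q) (suc j) = coeff-⊕ p q j

coeff-scale : ∀ c p j → coeff (scale c p) j ≡ c * coeff p j
coeff-scale c []      j       = sym (*-zeroʳ c)
coeff-scale c (a ∷ p) zero    = refl
coeff-scale c (a ∷ p) (suc j) = coeff-scale c p j

coeff-⊗ : ∀ p q j → coeff (p ⊗ q) j ≡ conv (coeff p) (coeff q) j
coeff-⊗ []      q j       = sym (conv-zeroˡ (coeff q) j)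
coeff-⊗ (a ∷ p) q zero    = trans (coeff-⊕ (scale a q) (0 ∷ p ⊗ q) 0)
                                  (trans (+-identityʳ _) (coeff-scale a q 0))
coeff-⊗ (a ∷ p) q (suc j) = trans (coeff-⊕ (scale a q) (0 ∷ p ⊗ q) (suc j))
                                  (cong₂ _+_ (coeff-scale a q (suc j)) (coeff-⊗ p q j))

coeff-constP⊗ : ∀ c q j → coeff (constP c ⊗ q) j ≡ c * coeff q j
coeff-constP⊗ c q zero    = trans (coeff-⊕ (scale c q) (0 ∷ []) 0) (trans (+-identityʳ _) (coeff-scale c q 0))
coeff-constP⊗ c q (suc j) = trans (coeff-⊕ (scale c q) (0 ∷ []) (suc j)) (trans (+-identityʳ _) (coeff-scale c q (suc j)))

-- A record rather than _≈P_ itself, so that the two polynomials can be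
-- inferred from an equality proof.
infix 4 _≋_
record _≋_ (p q : Poly) : Set where
  constructor coeffwise
  field coeff-≡ : ∀ j → coeff p j ≡ coeff q j
open _≋_ public

≋-isEquivalence : IsEquivalence _≋_
≋-isEquivalence = record
  { refl  = coeffwise λ _ → refl
  ; sym   = λ p≋q → coeffwise λ j → sym (coeff-≡ p≋q j)
  ; trans = λ p≋q q≋r → coeffwise λ j → trans (coeff-≡ p≋q j) (coeff-≡ q≋r j)
  }

≋-setoid : Setoid _ _
≋-setoid = record { isEquivalence = ≋-isEquivalence }

open Setoid ≋-setoid public using () renaming (refl to ≋-refl; sym to ≋-sym; trans to ≋-trans; reflexive to ≋-reflexive)

module ≋-Reasoning = Relation.Binary.Reasoning.Setoid ≋-setoid

coeffwise₅ : ∀ {p q} →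
  coeff p 0 ≡ coeff q 0 → coeff p 1 ≡ coeff q 1 → coeff p 2 ≡ coeff q 2 → coeff p 3 ≡ coeff q 3 →
  coeff p 4 ≡ coeff q 4 → (∀ j → coeff p (5 + j) ≡ coeff q (5 + j)) → p ≋ q
coeffwise₅ e₀ e₁ e₂ e₃ e₄ e₅₊ = coeffwise λ where
  0 → e₀
  1 → e₁
  2 → e₂
  3 → e₃
  4 → e₄
  (suc (suc (suc (suc (suc j))))) → e₅₊ j

⊕-cong : ∀ {p p′ q q′} → p ≋ p′ → q ≋ q′ → p ⊕ q ≋ p′ ⊕ q′
⊕-cong {p} {p′} {q} {q′} p≋p′ q≋q′ = coeffwise λ j → begin
  coeff (p ⊕ q) j           ≡⟨ coeff-⊕ p q j ⟩
  coeff p j + coeff q j     ≡⟨ cong₂ _+_ (coeff-≡ p≋p′ j) (coeff-≡ q≋q′ j) ⟩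
  coeff p′ j + coeff q′ j   ≡⟨ coeff-⊕ p′ q′ j ⟨
  coeff (p′ ⊕ q′) j         ∎
  where open ≡-Reasoning

⊗-cong : ∀ {p p′ q q′} → p ≋ p′ → q ≋ q′ → p ⊗ q ≋ p′ ⊗ q′
⊗-cong {p} {p′} {q} {q′} p≋p′ q≋q′ = coeffwise λ j → begin
  coeff (p ⊗ q) j                  ≡⟨ coeff-⊗ p q j ⟩
  conv (coeff p) (coeff q) j       ≡⟨ conv-cong (coeff-≡ p≋p′) (coeff-≡ q≋q′) j ⟩
  conv (coeff p′) (coeff q′) j     ≡⟨ coeff-⊗ p′ q′ j ⟨
  coeff (p′ ⊗ q′) j                ∎
  where open ≡-Reasoning

⊕-identityʳ : ∀ p → p ⊕ [] ≋ p
⊕-identityʳ p = coeffwise λ j → trans (coeff-⊕ p [] j) (+-identityʳ _)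

⊗-comm : ∀ p q → p ⊗ q ≋ q ⊗ p
⊗-comm p q = coeffwise λ j →
  trans (coeff-⊗ p q j) (trans (conv-comm (coeff p) (coeff q) j) (sym (coeff-⊗ q p j)))

⊗-assoc : ∀ p q r → (p ⊗ q) ⊗ r ≋ p ⊗ (q ⊗ r)
⊗-assoc p q r = coeffwise λ j → begin
  coeff ((p ⊗ q) ⊗ r) j                              ≡⟨ coeff-⊗ (p ⊗ q) r j ⟩
  conv (coeff (p ⊗ q)) (coeff r) j                   ≡⟨ conv-cong (coeff-⊗ p q) (λ _ → refl) j ⟩
  conv (conv (coeff p) (coeff q)) (coeff r) j        ≡⟨ conv-assoc (coeff p) (coeff q) (coeff r) j ⟩
  conv (coeff p) (conv (coeff q) (coeff r)) j        ≡⟨ conv-cong (λ _ → refl) (coeff-⊗ q r) j ⟨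
  conv (coeff p) (coeff (q ⊗ r)) j                   ≡⟨ coeff-⊗ p (q ⊗ r) j ⟨
  coeff (p ⊗ (q ⊗ r)) j                              ∎
  where open ≡-Reasoning

⊗-distribʳ : ∀ p q r → (p ⊕ q) ⊗ r ≋ p ⊗ r ⊕ q ⊗ r
⊗-distribʳ p q r = coeffwise λ j → begin
  coeff ((p ⊕ q) ⊗ r) j                                       ≡⟨ coeff-⊗ (p ⊕ q) r j ⟩
  conv (coeff (p ⊕ q)) (coeff r) j                            ≡⟨ conv-cong (coeff-⊕ p q) (λ _ → refl) j ⟩
  conv (λ i → coeff p i + coeff q i) (coeff r) j              ≡⟨ conv-distribʳ (coeff p) (coeff q) (coeff r) j ⟩
  conv (coeff p) (coeff r) j + conv (coeff q) (coeff r) j     ≡⟨ cong₂ _+_ (coeff-⊗ p r j) (coeff-⊗ q r j) ⟨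
  coeff (p ⊗ r) j + coeff (q ⊗ r) j                           ≡⟨ coeff-⊕ (p ⊗ r) (q ⊗ r) j ⟨
  coeff (p ⊗ r ⊕ q ⊗ r) j                                     ∎
  where open ≡-Reasoning

⊗-identityˡ : ∀ q → constP 1 ⊗ q ≋ q
⊗-identityˡ q = coeffwise λ j → trans (coeff-constP⊗ 1 q j) (*-identityˡ _)

constP-* : ∀ a b → constP (a * b) ≋ constP a ⊗ constP b
constP-* a b = coeffwise λ j → sym (trans (coeff-constP⊗ a (constP b) j) (a*coeff j))
  where
  a*coeff : ∀ j → a * coeff (constP b) j ≡ coeff (constP (a * b)) j
  a*coeff zero    = refl
  a*coeff (suc j) = *-zeroʳ a

∷-cong : ∀ a {p q} → p ≋ q → a ∷ p ≋ a ∷ q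
∷-cong a p≋q = coeffwise λ where
  zero    → refl
  (suc j) → coeff-≡ p≋q j

0∷-⊗ : ∀ p q → (0 ∷ p) ⊗ q ≋ 0 ∷ p ⊗ q
0∷-⊗ p q = coeffwise λ j → trans (coeff-⊕ (scale 0 q) (0 ∷ p ⊗ q) j)
                                  (cong (_+ coeff (0 ∷ p ⊗ q) j) (coeff-scale 0 q j))

monoP-+ : ∀ a b → monoP (a + b) ≋ monoP a ⊗ monoP b
monoP-+ zero    b = ≋-sym (⊗-identityˡ (monoP b))
monoP-+ (suc a) b = ≋-trans (∷-cong 0 (monoP-+ a b)) (≋-sym (0∷-⊗ (monoP a) (monoP b)))

⊗-commutativeSemigroup : CommutativeSemigroup _ _
⊗-commutativeSemigroup = record
  { _≈_ = _≋_
  ; _∙_ = _⊗_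
  ; isCommutativeSemigroup = record
    { isSemigroup = record
      { isMagma = record { isEquivalence = ≋-isEquivalence ; ∙-cong = ⊗-cong }
      ; assoc   = ⊗-assoc
      }
    ; comm = ⊗-comm
    }
  }

open CommutativeSemigroupProperties ⊗-commutativeSemigroup public
  using () renaming (x∙yz≈y∙xz to ⊗-swapˡ; xy∙z≈y∙xz to ⊗-swapʳ′)

∑ : {A : Set} → List A → (A → ℕ) → ℕ
∑ []       f = 0
∑ (x ∷ xs) f = f x + ∑ xs f

∑-cong : ∀ {A : Set} (xs : List A) {f g : A → ℕ} → (∀ x → f x ≡ g x) → ∑ xs f ≡ ∑ xs g
∑-cong []       f≗g = refl
∑-cong (x ∷ xs) f≗g = cong₂ _+_ (f≗g x) (∑-cong xs f≗g)

∑-congᴬ : ∀ {A : Set} {xs : List A} {f g : A → ℕ} → All (λ x → f x ≡ g x) xs → ∑ xs f ≡ ∑ xs g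
∑-congᴬ []           = refl
∑-congᴬ (fx≡gx ∷ eqs) = cong₂ _+_ fx≡gx (∑-congᴬ eqs)

∑-zero : ∀ {A : Set} (xs : List A) → ∑ xs (λ _ → 0) ≡ 0
∑-zero []       = refl
∑-zero (x ∷ xs) = ∑-zero xs

∑-++ : ∀ {A : Set} (xs ys : List A) f → ∑ (xs ++ ys) f ≡ ∑ xs f + ∑ ys f
∑-++ []       ys f = refl
∑-++ (x ∷ xs) ys f = trans (cong (f x +_) (∑-++ xs ys f)) (sym (+-assoc (f x) _ _))

∑-map : ∀ {A B : Set} (h : A → B) (xs : List A) f → ∑ (map h xs) f ≡ ∑ xs (λ x → f (h x))
∑-map h []       f = refl
∑-map h (x ∷ xs) f = cong (f (h x) +_) (∑-map h xs f)

∑-concatMap : ∀ {A B : Set} (g : A → List B) (xs : List A) f →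
              ∑ (concatMap g xs) f ≡ ∑ xs (λ x → ∑ (g x) f)
∑-concatMap g []       f = refl
∑-concatMap g (x ∷ xs) f = trans (∑-++ (g x) (concatMap g xs) f) (cong (∑ (g x) f +_) (∑-concatMap g xs f))

∑-+ : ∀ {A : Set} (xs : List A) f g → ∑ xs (λ x → f x + g x) ≡ ∑ xs f + ∑ xs g
∑-+ []       f g = refl
∑-+ (x ∷ xs) f g = trans (cong (f x + g x +_) (∑-+ xs f g)) (interchange (f x) (g x) _ _)

∑-filter : ∀ {A : Set} {P : A → Set} (P? : Decidable P) (xs : List A) f →
           ∑ (filter P? xs) f ≡ ∑ xs (λ x → if does (P? x) then f x else 0)
∑-filter P? []       f = refl
∑-filter P? (x ∷ xs) f with does (P? x)
... | true  = cong (f x +_) (∑-filter P? xs f)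
... | false = ∑-filter P? xs f

∑-seqs : ∀ {A : Set} (L : List A) n f → ∑ (seqs L (suc n)) f ≡ ∑ L (λ x → ∑ (seqs L n) (λ s → f (x ∷ s)))
∑-seqs L n f = trans (∑-concatMap (λ x → map (x ∷_) (seqs L n)) L f)
                     (∑-cong L (λ x → ∑-map (x ∷_) (seqs L n) f))

conv-∑ : ∀ {A : Set} (xs : List A) f (g : A → ℕ → ℕ) j →
         conv f (λ i → ∑ xs (λ x → g x i)) j ≡ ∑ xs (λ x → conv f (g x) j)
conv-∑ []       f g j = trans (conv-comm f (λ _ → 0) j) (conv-zeroˡ f j)
conv-∑ (x ∷ xs) f g j = trans (conv-distribˡ f (g x) (λ i → ∑ xs (λ y → g y i)) j)
                              (cong (conv f (g x) j +_) (conv-∑ xs f g j))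

∑P : {A : Set} → List A → (A → Poly) → Poly
∑P xs f = sumP (map f xs)

coeff-∑P : ∀ {A : Set} (xs : List A) f j → coeff (∑P xs f) j ≡ ∑ xs (λ x → coeff (f x) j)
coeff-∑P []       f j = refl
coeff-∑P (x ∷ xs) f j = trans (coeff-⊕ (f x) (∑P xs f) j) (cong (coeff (f x) j +_) (coeff-∑P xs f j))

∑P-cong : ∀ {A : Set} (xs : List A) {f g : A → Poly} → (∀ x → f x ≋ g x) → ∑P xs f ≋ ∑P xs g
∑P-cong []       f≋g = ≋-refl
∑P-cong (x ∷ xs) f≋g = ⊕-cong (f≋g x) (∑P-cong xs f≋g)

∑P-seqs : ∀ {A : Set} (L : List A) n f →
          ∑P (seqs L (suc n)) f ≋ ∑P L (λ x → ∑P (seqs L n) (λ s → f (x ∷ s)))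
∑P-seqs L n f = coeffwise λ j → begin
  coeff (∑P (seqs L (suc n)) f) j                             ≡⟨ coeff-∑P (seqs L (suc n)) f j ⟩
  ∑ (seqs L (suc n)) (λ w → coeff (f w) j)                    ≡⟨ ∑-seqs L n (λ w → coeff (f w) j) ⟩
  ∑ L (λ x → ∑ (seqs L n) (λ s → coeff (f (x ∷ s)) j))        ≡⟨ ∑-cong L (λ x → coeff-∑P (seqs L n) (λ s → f (x ∷ s)) j) ⟨
  ∑ L (λ x → coeff (∑P (seqs L n) (λ s → f (x ∷ s))) j)       ≡⟨ coeff-∑P L _ j ⟨
  coeff (∑P L (λ x → ∑P (seqs L n) (λ s → f (x ∷ s)))) j      ∎
  where open ≡-Reasoning

⊗-∑P : ∀ {A : Set} (xs : List A) c f → ∑P xs (λ x → c ⊗ f x) ≋ c ⊗ ∑P xs f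
⊗-∑P xs c f = coeffwise λ j → begin
  coeff (∑P xs (λ x → c ⊗ f x)) j                     ≡⟨ coeff-∑P xs (λ x → c ⊗ f x) j ⟩
  ∑ xs (λ x → coeff (c ⊗ f x) j)                      ≡⟨ ∑-cong xs (λ x → coeff-⊗ c (f x) j) ⟩
  ∑ xs (λ x → conv (coeff c) (coeff (f x)) j)         ≡⟨ conv-∑ xs (coeff c) (λ x → coeff (f x)) j ⟨
  conv (coeff c) (λ i → ∑ xs (λ x → coeff (f x) i)) j ≡⟨ conv-cong (λ _ → refl) (coeff-∑P xs f) j ⟨
  conv (coeff c) (coeff (∑P xs f)) j                  ≡⟨ coeff-⊗ c (∑P xs f) j ⟨
  coeff (c ⊗ ∑P xs f) j                               ∎
  where open ≡-Reasoning

-- Rather than Data.Bool.toℕ, so that altdesFrom unfolds to sums of bits.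
bit : Bool → ℕ
bit b = if b then 1 else 0

∑< : ℕ → (ℕ → ℕ) → ℕ
∑< zero    ψ = 0
∑< (suc K) ψ = ψ 0 + ∑< K (shift ψ)

∑-applyUpTo : ∀ (f : ℕ → ℕ) K φ → ∑ (applyUpTo f K) φ ≡ ∑< K (λ i → φ (f i))
∑-applyUpTo f zero    φ = refl
∑-applyUpTo f (suc K) φ = cong (φ (f 0) +_) (∑-applyUpTo (λ i → f (suc i)) K φ)

∑<-cong : ∀ K {φ ψ} → (∀ i → φ i ≡ ψ i) → ∑< K φ ≡ ∑< K ψ
∑<-cong zero    φ≗ψ = refl
∑<-cong (suc K) φ≗ψ = cong₂ _+_ (φ≗ψ 0) (∑<-cong K (λ i → φ≗ψ (suc i)))

∑<-+ : ∀ K φ ψ → ∑< K (λ i → φ i + ψ i) ≡ ∑< K φ + ∑< K ψ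
∑<-+ zero    φ ψ = refl
∑<-+ (suc K) φ ψ = trans (cong (φ 0 + ψ 0 +_) (∑<-+ K (shift φ) (shift ψ))) (interchange (φ 0) (ψ 0) _ _)

∑<-zero : ∀ K → ∑< K (λ _ → 0) ≡ 0
∑<-zero zero    = refl
∑<-zero (suc K) = ∑<-zero K

∑<-indicator : ∀ K a (h : ℕ → ℕ) → a < K → ∑< K (λ k → bit (a ≡ᵇ k) * h k) ≡ h a
∑<-indicator (suc K) zero    h _         = trans (cong (h 0 + 0 +_) (∑<-zero K)) (trans (+-identityʳ _) (+-identityʳ _))
∑<-indicator (suc K) (suc a) h (s≤s a<K) = ∑<-indicator K a (shift h) a<K

fibreSize : {A : Set} → (A → ℕ) → ℕ → List A → ℕ
fibreSize g k xs = length (filter (λ x → (g x ≡ᵇ k) 𝔹.≟ true) xs)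

fibreSize-∷ : ∀ {A : Set} (g : A → ℕ) k x xs → fibreSize g k (x ∷ xs) ≡ bit (g x ≡ᵇ k) + fibreSize g k xs
fibreSize-∷ g k x xs with g x ≡ᵇ k
... | true  = refl
... | false = refl

∑-byFibres : ∀ {A : Set} (xs : List A) (g : A → ℕ) (h : ℕ → ℕ) K → All (λ x → g x < K) xs →
             ∑ xs (λ x → h (g x)) ≡ ∑< K (λ k → fibreSize g k xs * h k)
∑-byFibres []       g h K _              = sym (∑<-zero K)
∑-byFibres (x ∷ xs) g h K (gx<K ∷ bounds) = sym (begin
  ∑< K (λ k → fibreSize g k (x ∷ xs) * h k)
    ≡⟨ ∑<-cong K (λ k → trans (cong (_* h k) (fibreSize-∷ g k x xs)) (*-distribʳ-+ (h k) (bit (g x ≡ᵇ k)) _)) ⟩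
  ∑< K (λ k → bit (g x ≡ᵇ k) * h k + fibreSize g k xs * h k)
    ≡⟨ ∑<-+ K _ _ ⟩
  ∑< K (λ k → bit (g x ≡ᵇ k) * h k) + ∑< K (λ k → fibreSize g k xs * h k)
    ≡⟨ cong₂ _+_ (∑<-indicator K (g x) h gx<K) (sym (∑-byFibres xs g h K bounds)) ⟩
  h (g x) + ∑ xs (λ x → h (g x)) ∎)
  where open ≡-Reasoning

open ℤ using (ℤ; +_; -[1+_]; ∣_∣; 0ℤ)

bothSigns : List Bool
bothSigns = true ∷ false ∷ []

withSign : Bool → ℕ → ℤ
withSign true  a = + a
withSign false a = ℤ.- (+ a)

-- The clause for a too-short sign list is junk; it only makes ∣applySigns∣ unconditional.
applySigns : List ℕ → List Bool → List ℤ
applySigns []      s       = []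
applySigns (a ∷ u) []      = + a ∷ applySigns u []
applySigns (a ∷ u) (x ∷ s) = withSign x a ∷ applySigns u s

∣applySigns∣ : ∀ u s → map ∣_∣ (applySigns u s) ≡ u
∣applySigns∣ []      s           = refl
∣applySigns∣ (a ∷ u) []          = cong (a ∷_) (∣applySigns∣ u [])
∣applySigns∣ (a ∷ u) (true ∷ s)  = cong (a ∷_) (∣applySigns∣ u s)
∣applySigns∣ (a ∷ u) (false ∷ s) = cong₂ _∷_ (ℤP.∣-i∣≡∣i∣ (+ a)) (∣applySigns∣ u s)

∑-signedWords : ∀ (L : List ℕ) n (ψ : List ℤ → ℕ) →
  ∑ (seqs (map +_ L ++ map (λ i → ℤ.- (+ i)) L) n) ψ ≡ ∑ (seqs L n) (λ u → ∑ (seqs bothSigns n) (λ s → ψ (applySigns u s)))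
∑-signedWords L zero    ψ = sym (+-identityʳ _)
∑-signedWords L (suc n) ψ = begin
  ∑ (seqs L± (suc n)) ψ
    ≡⟨ ∑-seqs L± n ψ ⟩
  ∑ L± (λ x → ∑ (seqs L± n) (λ w → ψ (x ∷ w)))
    ≡⟨ ∑-++ (map +_ L) (map (λ i → ℤ.- (+ i)) L) _ ⟩
  ∑ (map +_ L) (λ x → ∑ (seqs L± n) (λ w → ψ (x ∷ w))) + ∑ (map (λ i → ℤ.- (+ i)) L) (λ x → ∑ (seqs L± n) (λ w → ψ (x ∷ w)))
    ≡⟨ cong₂ _+_ (∑-map +_ L _) (∑-map (λ i → ℤ.- (+ i)) L _) ⟩
  ∑ L (λ a → ∑ (seqs L± n) (λ w → ψ (withSign true a ∷ w))) + ∑ L (λ a → ∑ (seqs L± n) (λ w → ψ (withSign false a ∷ w)))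
    ≡⟨ cong₂ _+_ (∑-cong L (λ a → ∑-signedWords L n (λ w → ψ (+ a ∷ w))))
                 (∑-cong L (λ a → ∑-signedWords L n (λ w → ψ (ℤ.- (+ a) ∷ w)))) ⟩
  ∑ L (signedAs true) + ∑ L (signedAs false)
    ≡⟨ ∑-+ L (signedAs true) (signedAs false) ⟨
  ∑ L (λ a → signedAs true a + signedAs false a)
    ≡⟨ ∑-cong L (λ a → ∑-+ (seqs L n) (λ u → tails true a u) (λ u → tails false a u)) ⟨
  ∑ L (λ a → ∑ (seqs L n) (λ u → tails true a u + tails false a u))
    ≡⟨ ∑-cong L (λ a → ∑-cong (seqs L n) (λ u → cong (λ t → tails true a u + t) (sym (+-identityʳ _)))) ⟩
  ∑ L (λ a → ∑ (seqs L n) (λ u → ∑ bothSigns (λ x → tails x a u)))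
    ≡⟨ ∑-cong L (λ a → ∑-cong (seqs L n) (λ u → ∑-seqs bothSigns n (λ s → ψ (applySigns (a ∷ u) s)))) ⟨
  ∑ L (λ a → ∑ (seqs L n) (λ u → ∑ (seqs bothSigns (suc n)) (λ s → ψ (applySigns (a ∷ u) s))))
    ≡⟨ ∑-seqs L n (λ u → ∑ (seqs bothSigns (suc n)) (λ s → ψ (applySigns u s))) ⟨
  ∑ (seqs L (suc n)) (λ u → ∑ (seqs bothSigns (suc n)) (λ s → ψ (applySigns u s))) ∎
  where
  open ≡-Reasoning
  L± : List ℤ
  L± = map +_ L ++ map (λ i → ℤ.- (+ i)) L
  tails : Bool → ℕ → List ℕ → ℕ
  tails x a u = ∑ (seqs bothSigns n) (λ s → ψ (withSign x a ∷ applySigns u s))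
  signedAs : Bool → ℕ → ℕ
  signedAs x a = ∑ (seqs L n) (tails x a)

∑-signedPerms : ∀ n (ψ : List ℤ → ℕ) →
  ∑ (signedPerms n) ψ ≡ ∑ (perms n) (λ u → ∑ (seqs bothSigns n) (λ s → ψ (applySigns u s)))
∑-signedPerms n ψ = begin
  ∑ (signedPerms n) ψ
    ≡⟨ ∑-filter (λ w → distinctℕ (map ∣_∣ w) 𝔹.≟ true) (seqs (signedVals n) n) ψ ⟩
  ∑ (seqs (signedVals n) n) (λ w → if distinct? (map ∣_∣ w) then ψ w else 0)
    ≡⟨ ∑-signedWords (oneTo n) n _ ⟩
  ∑ (seqs (oneTo n) n) (λ u → ∑ (seqs bothSigns n) (λ s → if distinct? (map ∣_∣ (applySigns u s)) then ψ (applySigns u s) else 0))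
    ≡⟨ ∑-cong (seqs (oneTo n) n) (λ u → ∑-cong (seqs bothSigns n) (λ s →
         cong (λ w → if distinct? w then ψ (applySigns u s) else 0) (∣applySigns∣ u s))) ⟩
  ∑ (seqs (oneTo n) n) (λ u → ∑ (seqs bothSigns n) (λ s → if distinct? u then ψ (applySigns u s) else 0))
    ≡⟨ ∑-cong (seqs (oneTo n) n) (λ u → ∑-if (distinct? u) (seqs bothSigns n)) ⟩
  ∑ (seqs (oneTo n) n) (λ u → if distinct? u then ∑ (seqs bothSigns n) (λ s → ψ (applySigns u s)) else 0)
    ≡⟨ ∑-filter (λ w → distinctℕ w 𝔹.≟ true) (seqs (oneTo n) n) _ ⟨
  ∑ (perms n) (λ u → ∑ (seqs bothSigns n) (λ s → ψ (applySigns u s))) ∎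
  where
  open ≡-Reasoning
  distinct? : List ℕ → Bool
  distinct? w = does (distinctℕ w 𝔹.≟ true)
  ∑-if : ∀ {A : Set} b (xs : List A) {f : A → ℕ} → ∑ xs (λ x → if b then f x else 0) ≡ (if b then ∑ xs f else 0)
  ∑-if true  xs = refl
  ∑-if false xs = ∑-zero xs

-- Summing over the signs of a fixed word

<ᵇ-true : ∀ {m n} → m < n → (m <ᵇ n) ≡ true
<ᵇ-true m<n = Equivalence.to T-≡ (<⇒<ᵇ m<n)

<ᵇ-false : ∀ {m n} → n ≤ m → (m <ᵇ n) ≡ false
<ᵇ-false {m}     {zero}  _         = refl
<ᵇ-false {suc m} {suc n} (s≤s n≤m) = <ᵇ-false n≤m

<ℤᵇ-true : ∀ {a b} → a ℤ.< b → (a <ℤᵇ b) ≡ true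
<ℤᵇ-true {a} {b} a<b = dec-true (a ℤ.<? b) a<b

<ℤᵇ-false : ∀ {a b} → b ℤ.< a → (a <ℤᵇ b) ≡ false
<ℤᵇ-false {a} {b} b<a = dec-false (a ℤ.<? b) (λ a<b → ℤP.<-asym a<b b<a)

∣c∣<m⇒c<+m : ∀ {m} c → ∣ c ∣ < m → c ℤ.< + m
∣c∣<m⇒c<+m (+ k)    k<m = ℤ.+<+ k<m
∣c∣<m⇒c<+m -[1+ k ] _   = ℤ.-<+

∣c∣<1+m⇒-[1+m]<c : ∀ {m} c → ∣ c ∣ < suc m → -[1+ m ] ℤ.< c
∣c∣<1+m⇒-[1+m]<c (+ k)    _         = ℤ.-<+
∣c∣<1+m⇒-[1+m]<c -[1+ k ] (s≤s k<m) = ℤ.-<- k<m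

compare-smallerʳ : ∀ a c → ∣ c ∣ < ∣ a ∣ → (a <ℤᵇ c) ≡ (a <ℤᵇ 0ℤ)
compare-smallerʳ (+ m)    c c<a = trans (<ℤᵇ-false (∣c∣<m⇒c<+m c c<a)) (sym (<ℤᵇ-false (ℤ.+<+ (m<n⇒0<n c<a))))
compare-smallerʳ -[1+ m ] c c<a = trans (<ℤᵇ-true (∣c∣<1+m⇒-[1+m]<c c c<a)) (sym (<ℤᵇ-true (ℤ.-<+ {m} {0})))

compare-smallerˡ : ∀ a c → ∣ c ∣ < ∣ a ∣ → (c <ℤᵇ a) ≡ not (a <ℤᵇ 0ℤ)
compare-smallerˡ (+ m)    c c<a = trans (<ℤᵇ-true (∣c∣<m⇒c<+m c c<a)) (cong not (sym (<ℤᵇ-false (ℤ.+<+ (m<n⇒0<n c<a)))))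
compare-smallerˡ -[1+ m ] c c<a = trans (<ℤᵇ-false (∣c∣<1+m⇒-[1+m]<c c c<a)) (cong not (sym (<ℤᵇ-true (ℤ.-<+ {m} {0}))))

even?-suc : ∀ j → even? (suc j) ≡ not (even? j)
even?-suc zero          = refl
even?-suc (suc zero)    = refl
even?-suc (suc (suc j)) = even?-suc j

altDescent : ℕ → ℤ → ℤ → Bool
altDescent j a c = if even? j then a <ℤᵇ c else c <ℤᵇ a

descendsOverSmaller : ℕ → ℤ → Bool
descendsOverSmaller j a = if even? j then a <ℤᵇ 0ℤ else not (a <ℤᵇ 0ℤ)

altDescent-smaller : ∀ j a c → ∣ c ∣ < ∣ a ∣ → altDescent j a c ≡ descendsOverSmaller j a
altDescent-smaller j a c c<a rewrite compare-smallerʳ a c c<a | compare-smallerˡ a c c<a with even? j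
... | true  = refl
... | false = refl

altDescent-larger : ∀ j a c → ∣ a ∣ < ∣ c ∣ → altDescent j a c ≡ descendsOverSmaller (suc j) c
altDescent-larger j a c a<c rewrite even?-suc j | compare-smallerʳ c a a<c | compare-smallerˡ c a a<c with even? j
... | true  = refl
... | false = refl

descendsOverSmaller-withSign : ∀ j b →
  descendsOverSmaller j (withSign false (suc b)) ≡ not (descendsOverSmaller j (withSign true (suc b)))
descendsOverSmaller-withSign j b
  rewrite <ℤᵇ-true (ℤ.-<+ {b} {0}) | <ℤᵇ-false (ℤ.+<+ (s≤s (z≤n {b}))) with even? j
... | true  = refl
... | false = refl

nextBelow : ℕ → List ℕ → Bool
nextBelow b []      = false
nextBelow b (c ∷ _) = c <ᵇ b

-- the alternating descent at j when the next letter is smaller than a in absolute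
-- value, so that the sign of a alone decides it
forcedDescent : ℕ → ℤ → List ℕ → ℕ
forcedDescent j a u = bit (nextBelow ∣ a ∣ u ∧ descendsOverSmaller j a)

1+x 1+x² : Poly
1+x  = 1 ∷ 1 ∷ []
1+x² = 1 ∷ 0 ∷ 1 ∷ []

-- indexed by the number of smaller neighbours: a valley contributes 2, a peak
-- 1 + x², a double ascent or double descent 1 + x
localFactor : ℕ → Poly
localFactor zero          = constP 2
localFactor (suc zero)    = 1+x
localFactor (suc (suc _)) = 1+x²

localFactors : ℕ → List ℕ → Poly
localFactors m []      = constP 1
localFactors m (b ∷ u) = localFactor (bit (m <ᵇ b) + bit (nextBelow b u)) ⊗ localFactors b u

Admissible : ℕ → List ℕ → Set
Admissible m []          = ⊤
Admissible m (zero ∷ u)  = ⊥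
Admissible m (suc b ∷ u) = m ≢ suc b × Admissible (suc b) u

signSum-ascending : ∀ d g →
  monoP (bit d + bit (g ∧ d)) ⊕ monoP (bit (not d) + bit (g ∧ not d)) ≋ monoP 0 ⊗ localFactor (1 + bit g)
signSum-ascending true  true  = coeffwise₅ refl refl refl refl refl λ _ → refl
signSum-ascending true  false = coeffwise₅ refl refl refl refl refl λ _ → refl
signSum-ascending false true  = coeffwise₅ refl refl refl refl refl λ _ → refl
signSum-ascending false false = coeffwise₅ refl refl refl refl refl λ _ → refl

signSum-descending : ∀ ν d g →
  monoP (bit ν + bit (g ∧ d)) ⊕ monoP (bit ν + bit (g ∧ not d)) ≋ monoP (bit ν) ⊗ localFactor (0 + bit g)
signSum-descending true  true  true  = coeffwise₅ refl refl refl refl refl λ _ → refl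
signSum-descending true  true  false = coeffwise₅ refl refl refl refl refl λ _ → refl
signSum-descending true  false true  = coeffwise₅ refl refl refl refl refl λ _ → refl
signSum-descending true  false false = coeffwise₅ refl refl refl refl refl λ _ → refl
signSum-descending false true  true  = coeffwise₅ refl refl refl refl refl λ _ → refl
signSum-descending false true  false = coeffwise₅ refl refl refl refl refl λ _ → refl
signSum-descending false false true  = coeffwise₅ refl refl refl refl refl λ _ → refl
signSum-descending false false false = coeffwise₅ refl refl refl refl refl λ _ → refl

signSum-nextLetter : ∀ j a b u → ∣ a ∣ ≢ suc b →
  monoP (bit (altDescent j a (withSign true (suc b))) + forcedDescent (suc j) (withSign true (suc b)) u) ⊕
  monoP (bit (altDescent j a (withSign false (suc b))) + forcedDescent (suc j) (withSign false (suc b)) u)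
  ≋ monoP (forcedDescent j a (suc b ∷ u)) ⊗ localFactor (bit (∣ a ∣ <ᵇ suc b) + bit (nextBelow (suc b) u))
signSum-nextLetter j a b u a≢b with <-cmp ∣ a ∣ (suc b)
... | tri≈ _ a≡b _ = ⊥-elim (a≢b a≡b)
... | tri< a<b _ _ rewrite <ᵇ-false (<⇒≤ a<b) | <ᵇ-true a<b = ≋-trans
  (≋-reflexive (cong₂ (λ e e′ → monoP e ⊕ monoP e′)
    (cong (λ x → bit x + bit (g ∧ d)) (altDescent-larger j a (+ suc b) a<b))
    (cong₂ (λ x y → bit x + bit (g ∧ y)) (trans (altDescent-larger j a -[1+ b ] a<b) d₋≡¬d₊) d₋≡¬d₊)))
  (signSum-ascending d g)
  where
  d g : Bool
  d = descendsOverSmaller (suc j) (+ suc b)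
  g = nextBelow (suc b) u
  d₋≡¬d₊ : descendsOverSmaller (suc j) -[1+ b ] ≡ not d
  d₋≡¬d₊ = descendsOverSmaller-withSign (suc j) b
... | tri> _ _ b<a rewrite <ᵇ-true b<a | <ᵇ-false (<⇒≤ b<a) = ≋-trans
  (≋-reflexive (cong₂ (λ e e′ → monoP e ⊕ monoP e′)
    (cong (λ x → bit x + bit (g ∧ d)) (altDescent-smaller j a (+ suc b) b<a))
    (cong₂ (λ x y → bit x + bit (g ∧ y)) (altDescent-smaller j a -[1+ b ] b<a) (descendsOverSmaller-withSign (suc j) b))))
  (signSum-descending (descendsOverSmaller j a) d g)
  where
  d g : Bool
  d = descendsOverSmaller (suc j) (+ suc b)
  g = nextBelow (suc b) u

monoP-collect : ∀ e₁ f₁ e₂ f₂ R →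
  monoP e₁ ⊗ (monoP f₁ ⊗ R) ⊕ (monoP e₂ ⊗ (monoP f₂ ⊗ R) ⊕ []) ≋ (monoP (e₁ + f₁) ⊕ monoP (e₂ + f₂)) ⊗ R
monoP-collect e₁ f₁ e₂ f₂ R = begin
  monoP e₁ ⊗ (monoP f₁ ⊗ R) ⊕ (monoP e₂ ⊗ (monoP f₂ ⊗ R) ⊕ [])
    ≈⟨ ⊕-cong (≋-sym (⊗-assoc (monoP e₁) (monoP f₁) R)) (⊕-identityʳ _) ⟩
  (monoP e₁ ⊗ monoP f₁) ⊗ R ⊕ monoP e₂ ⊗ (monoP f₂ ⊗ R)
    ≈⟨ ⊕-cong ≋-refl (≋-sym (⊗-assoc (monoP e₂) (monoP f₂) R)) ⟩
  (monoP e₁ ⊗ monoP f₁) ⊗ R ⊕ (monoP e₂ ⊗ monoP f₂) ⊗ R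
    ≈⟨ ⊕-cong (⊗-cong (≋-sym (monoP-+ e₁ f₁)) ≋-refl) (⊗-cong (≋-sym (monoP-+ e₂ f₂)) ≋-refl) ⟩
  monoP (e₁ + f₁) ⊗ R ⊕ monoP (e₂ + f₂) ⊗ R
    ≈⟨ ⊗-distribʳ (monoP (e₁ + f₁)) (monoP (e₂ + f₂)) R ⟨
  (monoP (e₁ + f₁) ⊕ monoP (e₂ + f₂)) ⊗ R ∎
  where open ≋-Reasoning

signSum-altdesFrom : ∀ j a u → Admissible ∣ a ∣ u →
  ∑P (seqs bothSigns (length u)) (λ s → monoP (altdesFrom j (a ∷ applySigns u s)))
  ≋ monoP (forcedDescent j a u) ⊗ localFactors ∣ a ∣ u
signSum-altdesFrom j a []          _                  = ≋-trans (⊕-identityʳ _) (≋-sym (⊗-identityˡ (constP 1)))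
signSum-altdesFrom j a (suc b ∷ u) (a≢b , admissible) = begin
  ∑P (seqs bothSigns (suc (length u))) (λ s → monoP (altdesFrom j (a ∷ applySigns (suc b ∷ u) s)))
    ≈⟨ ∑P-seqs bothSigns (length u) _ ⟩
  withNext (+ suc b) ⊕ (withNext -[1+ b ] ⊕ [])
    ≈⟨ ⊕-cong (factorOut (+ suc b) admissible) (⊕-cong (factorOut -[1+ b ] admissible) ≋-refl) ⟩
  monoP (e (+ suc b)) ⊗ (monoP (f (+ suc b)) ⊗ R) ⊕ (monoP (e -[1+ b ]) ⊗ (monoP (f -[1+ b ]) ⊗ R) ⊕ [])
    ≈⟨ monoP-collect (e (+ suc b)) (f (+ suc b)) (e -[1+ b ]) (f -[1+ b ]) R ⟩
  (monoP (e (+ suc b) + f (+ suc b)) ⊕ monoP (e -[1+ b ] + f -[1+ b ])) ⊗ R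
    ≈⟨ ⊗-cong (signSum-nextLetter j a b u a≢b) ≋-refl ⟩
  (monoP (forcedDescent j a (suc b ∷ u)) ⊗ localFactor (bit (∣ a ∣ <ᵇ suc b) + bit (nextBelow (suc b) u))) ⊗ R
    ≈⟨ ⊗-assoc (monoP (forcedDescent j a (suc b ∷ u))) _ R ⟩
  monoP (forcedDescent j a (suc b ∷ u)) ⊗ localFactors ∣ a ∣ (suc b ∷ u) ∎
  where
  open ≋-Reasoning
  R : Poly
  R = localFactors (suc b) u
  e f : ℤ → ℕ
  e c = bit (altDescent j a c)
  f c = forcedDescent (suc j) c u
  withNext : ℤ → Poly
  withNext c = ∑P (seqs bothSigns (length u)) (λ s → monoP (altdesFrom j (a ∷ c ∷ applySigns u s)))
  factorOut : ∀ c → Admissible ∣ c ∣ u → withNext c ≋ monoP (e c) ⊗ (monoP (f c) ⊗ localFactors ∣ c ∣ u)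
  factorOut c admissible = begin
    withNext c
      ≈⟨ ∑P-cong (seqs bothSigns (length u)) (λ s → monoP-+ (e c) (altdesFrom (suc j) (c ∷ applySigns u s))) ⟩
    ∑P (seqs bothSigns (length u)) (λ s → monoP (e c) ⊗ monoP (altdesFrom (suc j) (c ∷ applySigns u s)))
      ≈⟨ ⊗-∑P (seqs bothSigns (length u)) (monoP (e c)) _ ⟩
    monoP (e c) ⊗ ∑P (seqs bothSigns (length u)) (λ s → monoP (altdesFrom (suc j) (c ∷ applySigns u s)))
      ≈⟨ ⊗-cong (≋-refl {monoP (e c)}) (signSum-altdesFrom (suc j) c u admissible) ⟩
    monoP (e c) ⊗ (monoP (f c) ⊗ localFactors ∣ c ∣ u) ∎

-- The local factors of a permutation

shape : ℕ → ℕ → ℕ → Poly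
shape c p e = constP (2 ^ c) ⊗ powP 1+x² p ⊗ powP 1+x e

shape-1+x : ∀ c p e → 1+x ⊗ shape c p e ≋ shape c p (suc e)
shape-1+x c p e = ⊗-swapˡ 1+x (constP (2 ^ c) ⊗ powP 1+x² p) (powP 1+x e)

shape-1+x² : ∀ c p e → 1+x² ⊗ shape c p e ≋ shape c (suc p) e
shape-1+x² c p e = ≋-trans (≋-sym (⊗-assoc 1+x² (constP (2 ^ c) ⊗ powP 1+x² p) (powP 1+x e)))
                           (⊗-cong (⊗-swapˡ 1+x² (constP (2 ^ c)) (powP 1+x² p)) ≋-refl)

shape-2 : ∀ c p e → constP 2 ⊗ shape c p e ≋ shape (suc c) p e
shape-2 c p e = ≋-trans (≋-sym (⊗-assoc (constP 2) (constP (2 ^ c) ⊗ powP 1+x² p) (powP 1+x e)))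
  (⊗-cong (≋-trans (≋-sym (⊗-assoc (constP 2) (constP (2 ^ c)) (powP 1+x² p)))
                   (⊗-cong (≋-sym (constP-* 2 (2 ^ c))) ≋-refl)) ≋-refl)

StartsAbove : ℕ → List ℕ → Set
StartsAbove m []      = ⊤
StartsAbove m (b ∷ _) = m < b

-- A word entered by an ascent has as many valleys as peaks, one entered by a
-- descent has one valley more.
AscentShape : ℕ → List ℕ → Set
AscentShape m u = Σ ℕ λ e →
  length u ≡ 2 * peaks (m ∷ u) + e × localFactors m u ≋ shape (peaks (m ∷ u)) (peaks (m ∷ u)) e

DescentShape : ℕ → List ℕ → Set
DescentShape m u = Σ ℕ λ e →
  length u ≡ suc (2 * peaks (m ∷ u) + e) × localFactors m u ≋ shape (suc (peaks (m ∷ u))) (peaks (m ∷ u)) e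

TailShape : ℕ → List ℕ → Set
TailShape b []      = ⊤
TailShape b (c ∷ w) = (c < b → DescentShape b (c ∷ w)) × (b < c → AscentShape b (c ∷ w))

ascentStep : ∀ m b c w → m < suc b → suc b ≢ suc c → TailShape (suc b) (suc c ∷ w) →
             AscentShape m (suc b ∷ suc c ∷ w)
ascentStep m b c w m<b b≢c (descent , ascent) with <-cmp (suc c) (suc b)
... | tri≈ _ c≡b _ = ⊥-elim (b≢c (sym c≡b))
... | tri< c<b _ _ rewrite <ᵇ-true m<b | <ᵇ-true c<b =
  let e , len , eq = descent c<b
  in  e , trans (cong suc len) (cong (_+ e) (sym (*-suc 2 p))) , ≋-trans (⊗-cong (≋-refl {1+x²}) eq) (shape-1+x² (suc p) p e)
  where
  p : ℕ
  p = peaks (suc b ∷ suc c ∷ w)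
... | tri> _ _ b<c rewrite <ᵇ-true m<b | <ᵇ-false (<⇒≤ b<c) =
  let e , len , eq = ascent b<c
  in  suc e , trans (cong suc len) (sym (+-suc _ e)) , ≋-trans (⊗-cong (≋-refl {1+x}) eq) (shape-1+x p p e)
  where
  p : ℕ
  p = peaks (suc b ∷ suc c ∷ w)

descentStep : ∀ m b c w → suc b < m → suc b ≢ suc c → TailShape (suc b) (suc c ∷ w) →
              DescentShape m (suc b ∷ suc c ∷ w)
descentStep m b c w b<m b≢c (descent , ascent) with <-cmp (suc c) (suc b)
... | tri≈ _ c≡b _ = ⊥-elim (b≢c (sym c≡b))
... | tri< c<b _ _ rewrite <ᵇ-false (<⇒≤ b<m) | <ᵇ-true c<b =
  let e , len , eq = descent c<b
  in  suc e , cong suc (trans len (sym (+-suc _ e))) , ≋-trans (⊗-cong (≋-refl {1+x}) eq) (shape-1+x (suc p) p e)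
  where
  p : ℕ
  p = peaks (suc b ∷ suc c ∷ w)
... | tri> _ _ b<c rewrite <ᵇ-false (<⇒≤ b<m) | <ᵇ-false (<⇒≤ b<c) =
  let e , len , eq = ascent b<c
  in  e , cong suc len , ≋-trans (⊗-cong (≋-refl {constP 2}) eq) (shape-2 p p e)
  where
  p : ℕ
  p = peaks (suc b ∷ suc c ∷ w)

ascentShape  : ∀ m u → Admissible m u → StartsAbove m u → AscentShape m u
descentShape : ∀ m b u → Admissible m (b ∷ u) → b < m → DescentShape m (b ∷ u)
tailShape    : ∀ b u → Admissible b u → TailShape b u

ascentShape m []                  _                  _   = 0 , refl , coeffwise₅ refl refl refl refl refl λ _ → refl
ascentShape m (zero ∷ u)          ()                 _
ascentShape m (suc b ∷ [])        _                  m<b rewrite <ᵇ-true m<b =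
  1 , refl , coeffwise₅ refl refl refl refl refl λ _ → refl
ascentShape m (suc b ∷ zero ∷ w)  (_ , ())           _
ascentShape m (suc b ∷ suc c ∷ w) (_ , b≢c , adm) m<b =
  ascentStep m b c w m<b b≢c (tailShape (suc b) (suc c ∷ w) (b≢c , adm))

descentShape m zero    u           ()                 _
descentShape m (suc b) []          _                  b<m rewrite <ᵇ-false (<⇒≤ b<m) =
  0 , refl , coeffwise₅ refl refl refl refl refl λ _ → refl
descentShape m (suc b) (zero ∷ w)  (_ , ())           _
descentShape m (suc b) (suc c ∷ w) (_ , b≢c , adm) b<m =
  descentStep m b c w b<m b≢c (tailShape (suc b) (suc c ∷ w) (b≢c , adm))

tailShape b []      _   = _
tailShape b (c ∷ w) adm = (λ c<b → descentShape b c w adm c<b) , (λ b<c → ascentShape b (c ∷ w) adm b<c)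

forcedDescent-from-0 : ∀ u → forcedDescent 0 0ℤ u ≡ 0
forcedDescent-from-0 []      = refl
forcedDescent-from-0 (_ ∷ _) = refl

startsAbove-0 : ∀ u → Admissible 0 u → StartsAbove 0 u
startsAbove-0 []          _ = _
startsAbove-0 (zero ∷ u)  ()
startsAbove-0 (suc b ∷ u) _ = s≤s z≤n

2*lpk≤length : ∀ u → Admissible 0 u → 2 * lpk u ≤ length u
2*lpk≤length u admissible =
  let e , len , _ = ascentShape 0 u admissible (startsAbove-0 u admissible)
  in  subst (2 * lpk u ≤_) (sym len) (m≤m+n (2 * lpk u) e)

signSum-altdesB : ∀ u → Admissible 0 u →
  ∑P (seqs bothSigns (length u)) (λ s → monoP (altdesB (applySigns u s))) ≋ shape (lpk u) (lpk u) (length u ∸ 2 * lpk u)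
signSum-altdesB u admissible =
  let e , len , u≋shape = ascentShape 0 u admissible (startsAbove-0 u admissible)
      e≡ : e ≡ length u ∸ 2 * lpk u
      e≡ = trans (sym (m+n∸m≡n (2 * lpk u) e)) (cong (_∸ 2 * lpk u) (sym len))
  in  begin
        ∑P (seqs bothSigns (length u)) (λ s → monoP (altdesB (applySigns u s)))
          ≈⟨ signSum-altdesFrom 0 0ℤ u admissible ⟩
        monoP (forcedDescent 0 0ℤ u) ⊗ localFactors 0 u
          ≡⟨ cong (λ k → monoP k ⊗ localFactors 0 u) (forcedDescent-from-0 u) ⟩
        constP 1 ⊗ localFactors 0 u
          ≈⟨ ⊗-identityˡ (localFactors 0 u) ⟩
        localFactors 0 u
          ≈⟨ u≋shape ⟩
        shape (lpk u) (lpk u) e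
          ≡⟨ cong (shape (lpk u) (lpk u)) e≡ ⟩
        shape (lpk u) (lpk u) (length u ∸ 2 * lpk u) ∎
  where open ≋-Reasoning

seqs-all : ∀ {A : Set} {Q : A → Set} (L : List A) n → All Q L → All (λ w → length w ≡ n × All Q w) (seqs L n)
seqs-all L zero    _  = (refl , []) ∷ []
seqs-all L (suc n) qL = concat⁺ (map⁺ (All.map (λ qx → map⁺ (All.map (λ (len , qw) → cong suc len , qx ∷ qw) (seqs-all L n qL))) qL))

distinctℕ-tail : ∀ x xs → distinctℕ (x ∷ xs) ≡ true → distinctℕ xs ≡ true
distinctℕ-tail x xs distinct with any (x ≡ᵇ_) xs
... | false = distinct

distinctℕ-head : ∀ x c w → distinctℕ (x ∷ c ∷ w) ≡ true → x ≢ c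
distinctℕ-head x .x w distinct refl with x ≡ᵇ x | ≡⇒≡ᵇ x x refl
distinctℕ-head x .x w () refl | true | _

distinct⇒admissible : ∀ m b u → m ≢ b → All (0 <_) (b ∷ u) → distinctℕ (b ∷ u) ≡ true → Admissible m (b ∷ u)
distinct⇒admissible m zero    u       _   (() ∷ _)
distinct⇒admissible m (suc b) []      m≢b _          _        = m≢b , _
distinct⇒admissible m (suc b) (c ∷ w) m≢b (_ ∷ pos) distinct =
  m≢b , distinct⇒admissible (suc b) c w (distinctℕ-head (suc b) c w distinct) pos (distinctℕ-tail (suc b) (c ∷ w) distinct)

perms-admissible : ∀ n → All (λ u → length u ≡ n × Admissible 0 u) (perms n)
perms-admissible n = All.map admissible
  (All.zip (filter⁺ distinct? (seqs-all (oneTo n) n (oneTo-positive n)) , all-filter distinct? (seqs (oneTo n) n)))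
  where
  distinct? : Decidable (λ w → distinctℕ w ≡ true)
  distinct? w = distinctℕ w 𝔹.≟ true
  oneTo-positive : ∀ n → All (0 <_) (oneTo n)
  oneTo-positive n = map⁺ (All.universal (λ _ → s≤s z≤n) (upTo n))
  admissible : ∀ {u} → (length u ≡ n × All (0 <_) u) × distinctℕ u ≡ true → length u ≡ n × Admissible 0 u
  admissible {[]}    ((len , _)   , _)        = len , _
  admissible {b ∷ u} ((len , pos) , distinct) = len , distinct⇒admissible 0 b u (<⇒≢ (All.head pos)) pos distinct

signSum-perm : ∀ {n} u → length u ≡ n → Admissible 0 u → ∀ j →
  ∑ (seqs bothSigns n) (λ s → coeff (monoP (altdesB (applySigns u s))) j) ≡ coeff (shape (lpk u) (lpk u) (n ∸ 2 * lpk u)) j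
signSum-perm u refl admissible j =
  trans (sym (coeff-∑P (seqs bothSigns (length u)) _ j)) (coeff-≡ (signSum-altdesB u admissible) j)

lpk<1+n/2 : ∀ {n} u → length u ≡ n → Admissible 0 u → lpk u < suc (n / 2)
lpk<1+n/2 u refl admissible = s≤s (begin
  lpk u             ≡⟨ m*n/n≡m (lpk u) 2 ⟨
  lpk u * 2 / 2     ≤⟨ /-monoˡ-≤ 2 (subst (_≤ length u) (*-comm 2 (lpk u)) (2*lpk≤length u admissible)) ⟩
  length u / 2      ∎)
  where open ≤-Reasoning

scaled-shape : ∀ m c p e → constP (2 ^ c * m) ⊗ powP 1+x² p ⊗ powP 1+x e ≋ constP m ⊗ shape c p e
scaled-shape m c p e = begin
  constP (2 ^ c * m) ⊗ powP 1+x² p ⊗ powP 1+x e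
    ≈⟨ ⊗-cong (⊗-cong (constP-* (2 ^ c) m) (≋-refl {powP 1+x² p})) (≋-refl {powP 1+x e}) ⟩
  (constP (2 ^ c) ⊗ constP m) ⊗ powP 1+x² p ⊗ powP 1+x e
    ≈⟨ ⊗-cong (⊗-swapʳ′ (constP (2 ^ c)) (constP m) (powP 1+x² p)) (≋-refl {powP 1+x e}) ⟩
  constP m ⊗ (constP (2 ^ c) ⊗ powP 1+x² p) ⊗ powP 1+x e
    ≈⟨ ⊗-assoc (constP m) (constP (2 ^ c) ⊗ powP 1+x² p) (powP 1+x e) ⟩
  constP m ⊗ shape c p e ∎
  where open ≋-Reasoning

coeff-RHS : ∀ n j → coeff (RHS n) j ≡ ∑< (suc (n / 2)) (λ k → M n k * coeff (shape k k (n ∸ 2 * k)) j)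
coeff-RHS n j = begin
  coeff (RHS n) j
    ≡⟨ coeff-∑P (upTo (suc (n / 2))) term j ⟩
  ∑ (upTo (suc (n / 2))) (λ k → coeff (term k) j)
    ≡⟨ ∑-applyUpTo (λ k → k) (suc (n / 2)) _ ⟩
  ∑< (suc (n / 2)) (λ k → coeff (term k) j)
    ≡⟨ ∑<-cong (suc (n / 2)) (λ k → trans (coeff-≡ (scaled-shape (M n k) k k (n ∸ 2 * k)) j) (coeff-constP⊗ (M n k) (shape k k (n ∸ 2 * k)) j)) ⟩
  ∑< (suc (n / 2)) (λ k → M n k * coeff (shape k k (n ∸ 2 * k)) j) ∎
  where
  open ≡-Reasoning
  term : ℕ → Poly
  term k = constP (2 ^ k * M n k) ⊗ powP 1+x² k ⊗ powP 1+x (n ∸ 2 * k)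

mainTheorem6 : (n : ℕ) → BHat n ≈P RHS n
mainTheorem6 n j = begin
  coeff (BHat n) j
    ≡⟨ coeff-∑P (signedPerms n) (λ σ → monoP (altdesB σ)) j ⟩
  ∑ (signedPerms n) (λ σ → coeff (monoP (altdesB σ)) j)
    ≡⟨ ∑-signedPerms n (λ σ → coeff (monoP (altdesB σ)) j) ⟩
  ∑ (perms n) (λ u → ∑ (seqs bothSigns n) (λ s → coeff (monoP (altdesB (applySigns u s))) j))
    ≡⟨ ∑-congᴬ (All.map (λ {u} (len , admissible) → signSum-perm u len admissible j) (perms-admissible n)) ⟩
  ∑ (perms n) (λ u → weight (lpk u))
    ≡⟨ ∑-byFibres (perms n) lpk weight (suc (n / 2))
         (All.map (λ {u} (len , admissible) → lpk<1+n/2 u len admissible) (perms-admissible n)) ⟩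
  ∑< (suc (n / 2)) (λ k → M n k * weight k)
    ≡⟨ coeff-RHS n j ⟨
  coeff (RHS n) j ∎
  where
  open ≡-Reasoning
  weight : ℕ → ℕ
  weight k = coeff (shape k k (n ∸ 2 * k)) j
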